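{- Let $G$ be a graph with vertex set $\{a_1,\ldots,a_n\}$ and let $G^*$ be constructed as follows. Start with the Cartesian product $G\,\square\,K_n$, where $V(K_n)=\{v_1,\ldots,v_n\}$ (vertices $(a_i,v_k)$; edges $(a_i,v_k)(a_j,v_k)$ whenever $a_ia_j\in E(G)$, and $(a_i,v_k)(a_i,v_l)$ for all $i$ and distinct $k,l$). For each $(i,j)\in[n]\times[n]$ with $i\ne j$ add two new vertices $b_{ij},c_{ij}$, with edges $b_{ij}c_{ij}$ and $b_{ij}(a_i,v_j)$; finally, for each $i\in[n]$ make $b_{ij}$ and $b_{ik}$ adjacent whenever $j\ne k$. Then $\rho(G^*)=n(n-1)+\alpha(G)$. In addition, $G$ has a unique maximum independent set if and only if $G^*$ has a unique maximum 2-packing.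
   Context: A 2-packing is a set of vertices whose closed neighborhoods are pairwise disjoint; $\rho$ denotes the maximum cardinality of a 2-packing. $\alpha(G)$ is the independence number of $G$. -}

module Defs where

open import Data.Nat using (ℕ; _≤_)
open import Data.Fin using (Fin)
open import Data.List using (List; length)
open import Data.List.Membership.Propositional using (_∈_)
open import Data.List.Relation.Unary.Unique.Propositional using (Unique)
open import Data.Product using (Σ; _×_; ∃)
open import Data.Sum using (_⊎_)
open import Data.Empty using (⊥)
open import Relation.Nullary using (¬_; Dec)
open import Relation.Binary.PropositionalEquality using (_≡_; _≢_)

-- Generic notions for a (simple) graph given by its adjacency relation
-- on a vertex type V. Vertex sets are duplicate-free lists.

module _ {V : Set} (Adj : V → V → Set) where

  ClosedNbhd : V → V → Set
  ClosedNbhd u w = (w ≡ u) ⊎ Adj u w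

  Independent : List V → Set
  Independent S = ∀ {u v} → u ∈ S → v ∈ S → ¬ Adj u v

  TwoPacking : List V → Set
  TwoPacking S = ∀ {u v} → u ∈ S → v ∈ S → u ≢ v →
                 ∀ w → ¬ (ClosedNbhd u w × ClosedNbhd v w)

  IsMaximum : (List V → Set) → List V → Set
  IsMaximum P S = P S × Unique S × (∀ T → P T → Unique T → length T ≤ length S)

  MaxCard : (List V → Set) → ℕ → Set
  MaxCard P k = Σ (List V) λ S → IsMaximum P S × length S ≡ k

  SameSet : List V → List V → Set
  SameSet S T = ∀ x → (x ∈ S → x ∈ T) × (x ∈ T → x ∈ S)

  UniqueMaximum : (List V → Set) → Set
  UniqueMaximum P = Σ (List V) λ S → IsMaximum P S ×
                    (∀ T → IsMaximum P T → SameSet S T)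

  IndependenceNumber : ℕ → Set
  IndependenceNumber = MaxCard Independent

  PackingNumber : ℕ → Set
  PackingNumber = MaxCard TwoPacking

record SimpleGraph (n : ℕ) : Set₁ where
  field
    Adj     : Fin n → Fin n → Set
    adj?    : ∀ i j → Dec (Adj i j)
    sym     : ∀ {i j} → Adj i j → Adj j i
    irrefl  : ∀ {i} → ¬ Adj i i
open SimpleGraph public

-- The graph G*.
-- Vertices: a i k  = (a_i , v_k) of G □ K_n;
--           b i j , c i j = b_ij , c_ij  for i ≢ j (proof irrelevant).

data StarV (n : ℕ) : Set where
  a : Fin n → Fin n → StarV n
  b : (i j : Fin n) → .(i ≢ j) → StarV n
  c : (i j : Fin n) → .(i ≢ j) → StarV n

-- generating edges (one orientation each)
data StarEdge {n : ℕ} (G : SimpleGraph n) : StarV n → StarV n → Set where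
  aa-G  : ∀ {i j k} → Adj G i j → StarEdge G (a i k) (a j k)
  aa-K  : ∀ {i k l} → k ≢ l → StarEdge G (a i k) (a i l)
  bc    : ∀ {i j} .{p : i ≢ j} → StarEdge G (b i j p) (c i j p)
  ba    : ∀ {i j} .{p : i ≢ j} → StarEdge G (b i j p) (a i j)
  bb    : ∀ {i j k} .{p : i ≢ j} .{q : i ≢ k} → j ≢ k →
          StarEdge G (b i j p) (b i k q)

StarAdj : {n : ℕ} → SimpleGraph n → StarV n → StarV n → Set
StarAdj G u v = StarEdge G u v ⊎ StarEdge G v u

-- Every vertex x of G* gets a slot: a diagonal vertex (a_i,v_i) gets the slot i,
-- every other vertex lies in exactly one gadget {(a_i,v_j), b_ij, c_ij} (i ≠ j) and
-- gets the slot (i,j).  All vertices of a gadget lie in N[b_ij], so a 2-packing T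
-- meets each slot at most once; its diagonal slots form an independent set
-- diagonalOf T of G.  Conversely, for an independent set I of G,
--   packingOf I = { c_ij | i ≠ j } ∪ { (a_i,v_i) | i ∈ I }
-- is a 2-packing of size n(n-1) + |I| which uses every slot that T can use, so
-- |T| ≤ |packingOf (diagonalOf T)|.  Hence packingOf maps maximum independent sets
-- to maximum 2-packings and diagonalOf maps back.  For a maximum 2-packing T every
-- gadget is occupied (slot counting) and, since diagonalOf T dominates G, the occupant
-- must be the leaf c_ij; so T = packingOf (diagonalOf T).  Both uniqueness
-- statements are then transported along this correspondence.

module Submission where

open import Defs
open import Data.Nat using (ℕ; _+_; _*_; _∸_)
open import Data.Product using (_×_)
open import Function.Bundles using (_⇔_)

open import Data.Nat using (zero; suc; _≤_; _<_; z≤n; s≤s)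
open import Data.Nat.Properties using (≤-trans; <-irrefl; +-monoʳ-≤; +-cancelˡ-≤; module ≤-Reasoning)
open import Data.Fin using (Fin; punchIn; punchOut) renaming (_≟_ to _≟F_)
open import Data.Fin.Properties using (punchInᵢ≢i; punchIn-injective; punchIn-punchOut)
open import Data.List using (List; []; _∷_; _++_; map; length; allFin; filter)
open import Data.List.Properties using (length-++; length-map; length-tabulate; length-removeAt′)
open import Data.List.Membership.Propositional using (_∈_; _∉_; _─_; find; lose)
open import Data.List.Membership.Propositional.Properties
  using (∈-++⁺ˡ; ∈-++⁺ʳ; ∈-++⁻; ∈-map⁺; ∈-map⁻; ∈-allFin; ∈-filter⁺; ∈-filter⁻)
open import Data.List.Relation.Binary.Subset.Propositional using (_⊆_)
open import Data.List.Relation.Unary.Any using (here; there; index; any?)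
import Data.List.Relation.Unary.All as All
import Data.List.Relation.Unary.All.Properties as All
open import Data.List.Relation.Unary.Unique.Propositional using (Unique; []; _∷_)
import Data.List.Relation.Unary.Unique.Propositional.Properties as Unique
open import Data.Product using (Σ; ∃; _,_; proj₁; proj₂)
import Data.Product.Properties as Product
open import Data.Sum using (_⊎_; inj₁; inj₂)
import Data.Sum.Properties as Sum
open import Data.Empty using (⊥; ⊥-elim)
import Data.Empty.Irrelevant as Irrelevant
open import Relation.Nullary using (¬_; Dec; yes; no)
open import Relation.Nullary.Decidable using (map′; _×-dec_)
open import Relation.Binary.Definitions using (DecidableEquality)
open import Relation.Binary.PropositionalEquality
  using (_≡_; _≢_; refl; cong; cong₂; subst; subst₂; ≢-sym)
import Relation.Binary.PropositionalEquality as ≡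
open import Function.Bundles using (mk⇔)

module _ {A : Set} where

  ∈-─ : ∀ {y z : A} {ys} (y∈ys : y ∈ ys) → z ∈ ys → z ≢ y → z ∈ ys ─ y∈ys
  ∈-─ (here refl) (here refl) z≢y = ⊥-elim (z≢y refl)
  ∈-─ (here refl) (there z∈ys) _  = z∈ys
  ∈-─ (there _)   (here refl)  _  = here refl
  ∈-─ (there y∈ys) (there z∈ys) z≢y = there (∈-─ y∈ys z∈ys z≢y)

  card-≤ : ∀ {xs ys : List A} → Unique xs → xs ⊆ ys → length xs ≤ length ys
  card-≤ [] _ = z≤n
  card-≤ {x ∷ xs} {ys} (x∉xs ∷ u) xs⊆ys = begin
      suc (length xs)          ≤⟨ s≤s (card-≤ u xs⊆ys─x) ⟩
      suc (length (ys ─ x∈ys)) ≡⟨ ≡.sym (length-removeAt′ ys (index x∈ys)) ⟩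
      length ys                ∎
    where
    open ≤-Reasoning
    x∈ys : x ∈ ys
    x∈ys = xs⊆ys (here refl)
    xs⊆ys─x : xs ⊆ ys ─ x∈ys
    xs⊆ys─x z∈xs = ∈-─ x∈ys (xs⊆ys (there z∈xs)) (≢-sym (All.lookup x∉xs z∈xs))

  card-saturated : DecidableEquality A → ∀ {xs ys : List A} →
                   Unique xs → xs ⊆ ys → length ys ≤ length xs → ys ⊆ xs
  card-saturated _≟_ {xs} {ys} u xs⊆ys ys≤xs {y} y∈ys with any? (y ≟_) xs
  ... | yes y∈xs = y∈xs
  ... | no  y∉xs = ⊥-elim (<-irrefl refl (≤-trans xs<ys ys≤xs))
    where
    xs<ys : length xs < length ys
    xs<ys = subst (length xs <_) (≡.sym (length-removeAt′ ys (index y∈ys)))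
      (s≤s (card-≤ u λ z∈xs → ∈-─ y∈ys (xs⊆ys z∈xs) λ { refl → y∉xs z∈xs }))

map-Unique : ∀ {A B : Set} (f : A → B) {xs : List A} →
             (∀ {x y} → x ∈ xs → y ∈ xs → f x ≡ f y → x ≡ y) →
             Unique xs → Unique (map f xs)
map-Unique f _ [] = []
map-Unique f inj (x∉xs ∷ u) =
  All.map⁺ (All.tabulate λ y∈xs fx≡fy → All.lookup x∉xs y∈xs (inj (here refl) (there y∈xs) fx≡fy))
  ∷ map-Unique f (λ x∈ y∈ → inj (there x∈) (there y∈)) u

module _ {V : Set} {R : V → V → Set} where

  sameSet-sym : ∀ {S T} → SameSet R S T → SameSet R T S
  sameSet-sym S≈T x = proj₂ (S≈T x) , proj₁ (S≈T x)

  sameSet-trans : ∀ {S T U} → SameSet R S T → SameSet R T U → SameSet R S U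
  sameSet-trans S≈T T≈U x =
    (λ x∈S → proj₁ (T≈U x) (proj₁ (S≈T x) x∈S)) , (λ x∈U → proj₂ (S≈T x) (proj₂ (T≈U x) x∈U))

module _ {n : ℕ} (G : SimpleGraph n) where

  independent-∷ : ∀ {I} i → Independent (Adj G) I → (∀ {j} → j ∈ I → ¬ Adj G i j) →
                  Independent (Adj G) (i ∷ I)
  independent-∷ i ind free (here refl) (here refl) = irrefl G
  independent-∷ i ind free (here refl) (there v∈I) = free v∈I
  independent-∷ i ind free (there u∈I) (here refl) = λ adj → free u∈I (sym G adj)
  independent-∷ i ind free (there u∈I) (there v∈I) = ind u∈I v∈I

  maximum-dominates : ∀ {I} → IsMaximum (Adj G) (Independent (Adj G)) I →
                      ∀ {i} → i ∉ I → ∃ λ j → j ∈ I × Adj G i j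
  maximum-dominates {I} (ind , u , largest) {i} i∉I with any? (adj? G i) I
  ... | yes adjacent = find adjacent
  ... | no none = ⊥-elim (<-irrefl refl (largest (i ∷ I) ind′ u′))
    where
    ind′ : Independent (Adj G) (i ∷ I)
    ind′ = independent-∷ i ind λ j∈I adj → none (lose j∈I adj)
    u′ : Unique (i ∷ I)
    u′ = All.tabulate (λ { j∈I refl → i∉I j∈I }) ∷ u

recover : ∀ {n} {i j : Fin n} → .(i ≢ j) → i ≢ j
recover i≢j i≡j = Irrelevant.⊥-elim (i≢j i≡j)

-- Equality of vertices of G* is decidable (the i ≢ j labels are irrelevant).
_≟V_ : ∀ {n} → DecidableEquality (StarV n)
a i k ≟V a i′ k′ = map′ (λ { (refl , refl) → refl }) (λ { refl → refl , refl }) ((i ≟F i′) ×-dec (k ≟F k′))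
b i j _ ≟V b i′ j′ _ = map′ (λ { (refl , refl) → refl }) (λ { refl → refl , refl }) ((i ≟F i′) ×-dec (j ≟F j′))
c i j _ ≟V c i′ j′ _ = map′ (λ { (refl , refl) → refl }) (λ { refl → refl , refl }) ((i ≟F i′) ×-dec (j ≟F j′))
a _ _   ≟V b _ _ _ = no λ ()
a _ _   ≟V c _ _ _ = no λ ()
b _ _ _ ≟V a _ _   = no λ ()
b _ _ _ ≟V c _ _ _ = no λ ()
c _ _ _ ≟V a _ _   = no λ ()
c _ _ _ ≟V b _ _ _ = no λ ()

data Leaf {n : ℕ} : StarV n → Set where
  leaf : ∀ i j .(i≢j : i ≢ j) → Leaf (c i j i≢j)

-- Row i of the leaves is enumerated as c_i(punchIn i j), j : Fin m, where n = m + 1.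
module Leaves (m : ℕ) where

  punchIn≢ : (i : Fin (suc m)) (j : Fin m) → i ≢ punchIn i j
  punchIn≢ i j i≡ = punchInᵢ≢i i j (≡.sym i≡)

  row : Fin (suc m) → List (StarV (suc m))
  row i = map (λ j → c i (punchIn i j) (punchIn≢ i j)) (allFin m)

  rows : List (Fin (suc m)) → List (StarV (suc m))
  rows []       = []
  rows (i ∷ is) = row i ++ rows is

  length-rows : ∀ is → length (rows is) ≡ length is * m
  length-rows []       = refl
  length-rows (i ∷ is) = ≡.trans (length-++ (row i))
    (cong₂ _+_ (≡.trans (length-map _ (allFin m)) (length-tabulate (λ j → j))) (length-rows is))

  ∈-row⁻ : ∀ {i x} → x ∈ row i → ∃ λ j → Σ (i ≢ j) λ i≢j → x ≡ c i j i≢j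
  ∈-row⁻ {i} x∈ with ∈-map⁻ _ x∈
  ... | j , _ , refl = punchIn i j , punchIn≢ i j , refl

  ∈-rows⁻ : ∀ {is x} → x ∈ rows is → ∃ λ i → i ∈ is × x ∈ row i
  ∈-rows⁻ {i ∷ is} x∈ with ∈-++⁻ (row i) x∈
  ... | inj₁ x∈row  = i , here refl , x∈row
  ... | inj₂ x∈rows = let (i′ , i′∈is , x∈row) = ∈-rows⁻ x∈rows in i′ , there i′∈is , x∈row

  ∈-row⁺ : ∀ i j .(i≢j : i ≢ j) → c i j i≢j ∈ row i
  ∈-row⁺ i j i≢j = at (punchOut (recover i≢j)) (punchIn-punchOut (recover i≢j))
    where
    at : ∀ j′ → punchIn i j′ ≡ j → c i j i≢j ∈ row i
    at j′ refl = ∈-map⁺ (λ j → c i (punchIn i j) (punchIn≢ i j)) (∈-allFin j′)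

  ∈-rows⁺ : ∀ {is i x} → i ∈ is → x ∈ row i → x ∈ rows is
  ∈-rows⁺ {i ∷ is} (here refl) x∈row = ∈-++⁺ˡ x∈row
  ∈-rows⁺ {i ∷ is} (there i∈is) x∈row = ∈-++⁺ʳ (row i) (∈-rows⁺ i∈is x∈row)

  row-unique : ∀ i → Unique (row i)
  row-unique i = Unique.map⁺ (λ {j} {j′} eq → punchIn-injective i j j′ (column eq)) (Unique.allFin⁺ m)
    where
    column : ∀ {j j′} .{p q} → c {suc m} i j p ≡ c i j′ q → j ≡ j′
    column refl = refl

  -- Different rows are disjoint, because the row of a leaf is determined.
  rows-unique : ∀ {is} → Unique is → Unique (rows is)
  rows-unique []                   = []
  rows-unique {i ∷ is} (i∉is ∷ u) = Unique.++⁺ (row-unique i) (rows-unique u) disjoint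
    where
    disjoint : ∀ {x} → ¬ (x ∈ row i × x ∈ rows is)
    disjoint (x∈row , x∈rows) with ∈-rows⁻ {is} x∈rows
    ... | i′ , i′∈is , x∈row′ with ∈-row⁻ x∈row | ∈-row⁻ x∈row′
    ...   | _ , _ , refl | _ , _ , refl = All.lookup i∉is i′∈is refl

leaves : ∀ n → List (StarV n)
leaves zero    = []
leaves (suc m) = Leaves.rows m (allFin (suc m))

length-leaves : ∀ n → length (leaves n) ≡ n * (n ∸ 1)
length-leaves zero    = refl
length-leaves (suc m) = ≡.trans (Leaves.length-rows m (allFin (suc m)))
  (cong (_* m) (length-tabulate {n = suc m} (λ i → i)))

leaves-unique : ∀ n → Unique (leaves n)
leaves-unique zero    = []
leaves-unique (suc m) = Leaves.rows-unique m (Unique.allFin⁺ (suc m))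

∈-leaves⁺ : ∀ {n} (i j : Fin n) .(i≢j : i ≢ j) → c i j i≢j ∈ leaves n
∈-leaves⁺ {suc m} i j i≢j = Leaves.∈-rows⁺ m (∈-allFin i) (Leaves.∈-row⁺ m i j i≢j)

∈-leaves⁻ : ∀ {n x} → x ∈ leaves n → Leaf x
∈-leaves⁻ {suc m} x∈ with Leaves.∈-rows⁻ m {allFin (suc m)} x∈
... | _ , _ , x∈row with Leaves.∈-row⁻ m x∈row
...   | j , i≢j , refl = leaf _ j i≢j

module Star {n : ℕ} (G : SimpleGraph n) where

  V : Set
  V = StarV n

  N : V → V → Set
  N = ClosedNbhd (StarAdj G)

  Packing : List V → Set
  Packing = TwoPacking (StarAdj G)

  Ind : List (Fin n) → Set
  Ind = Independent (Adj G)

  clash : ∀ {T x y w} → Packing T → x ∈ T → y ∈ T → x ≢ y → N x w → N y w → ⊥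
  clash pk x∈T y∈T x≢y nx ny = pk x∈T y∈T x≢y _ (nx , ny)

  N-row : ∀ i k l → N (a i k) (a i l)
  N-row i k l with k ≟F l
  ... | yes refl = inj₁ refl
  ... | no  k≢l  = inj₂ (inj₁ (aa-K k≢l))

  Slot : Set
  Slot = Fin n ⊎ (Fin n × Fin n)

  _≟S_ : DecidableEquality Slot
  _≟S_ = Sum.≡-dec _≟F_ (Product.≡-dec _≟F_ _≟F_)

  slot : V → Slot
  slot (a i k) with i ≟F k
  ... | yes _ = inj₁ i
  ... | no  _ = inj₂ (i , k)
  slot (b i j _) = inj₂ (i , j)
  slot (c i j _) = inj₂ (i , j)

  data Gadget (i j : Fin n) .(i≢j : i ≢ j) : V → Set where
    at-a : Gadget i j i≢j (a i j)
    at-b : Gadget i j i≢j (b i j i≢j)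
    at-c : Gadget i j i≢j (c i j i≢j)

  slot-diagonal : ∀ i → slot (a i i) ≡ inj₁ i
  slot-diagonal i with i ≟F i
  ... | yes _   = refl
  ... | no  i≢i = ⊥-elim (i≢i refl)

  slot-inj₁ : ∀ {x i} → slot x ≡ inj₁ i → x ≡ a i i
  slot-inj₁ {a i k} eq with i ≟F k
  slot-inj₁ {a i k} refl | yes refl = refl
  slot-inj₁ {a i k} ()   | no  _

  slot-inj₂ : ∀ {x i j} → slot x ≡ inj₂ (i , j) → Σ (i ≢ j) λ i≢j → Gadget i j i≢j x
  slot-inj₂ {a i k} eq with i ≟F k
  slot-inj₂ {a i k} ()   | yes _
  slot-inj₂ {a i k} refl | no i≢k = i≢k , at-a
  slot-inj₂ {b i j i≢j} refl = recover i≢j , at-b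
  slot-inj₂ {c i j i≢j} refl = recover i≢j , at-c

  gadget-near-centre : ∀ {i j x} .{i≢j} → Gadget i j i≢j x → N x (b i j i≢j)
  gadget-near-centre at-a = inj₂ (inj₂ ba)
  gadget-near-centre at-b = inj₁ refl
  gadget-near-centre at-c = inj₂ (inj₂ bc)

  slot-injective : ∀ {T x y} → Packing T → x ∈ T → y ∈ T → slot x ≡ slot y → x ≡ y
  slot-injective {x = x} {y} pk x∈T y∈T eq with slot y in eqy
  ... | inj₁ i = ≡.trans (slot-inj₁ eq) (≡.sym (slot-inj₁ eqy))
  ... | inj₂ (i , j) with slot-inj₂ eq | slot-inj₂ eqy | x ≟V y
  ...   | _ | _ | yes x≡y = x≡y
  ...   | _ , gx | _ , gy | no x≢y =
    ⊥-elim (clash pk x∈T y∈T x≢y (gadget-near-centre gx) (gadget-near-centre gy))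

  packingOf : List (Fin n) → List V
  packingOf I = leaves n ++ map (λ i → a i i) I

  length-packingOf : ∀ I → length (packingOf I) ≡ n * (n ∸ 1) + length I
  length-packingOf I = ≡.trans (length-++ (leaves n)) (cong₂ _+_ (length-leaves n) (length-map _ I))

  ∈-packingOf⁻ : ∀ {I x} → x ∈ packingOf I → Leaf x ⊎ ∃ λ i → i ∈ I × x ≡ a i i
  ∈-packingOf⁻ x∈ with ∈-++⁻ (leaves n) x∈
  ... | inj₁ x∈leaves = inj₁ (∈-leaves⁻ x∈leaves)
  ... | inj₂ x∈diag   = inj₂ (∈-map⁻ _ x∈diag)

  diagonal∈packingOf : ∀ {I i} → i ∈ I → a i i ∈ packingOf I
  diagonal∈packingOf i∈I = ∈-++⁺ʳ (leaves n) (∈-map⁺ _ i∈I)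

  diagonal∈packingOf⁻ : ∀ {I i} → a i i ∈ packingOf I → i ∈ I
  diagonal∈packingOf⁻ a∈ with ∈-packingOf⁻ a∈
  ... | inj₁ ()
  ... | inj₂ (_ , i∈I , refl) = i∈I

  leaf∈packingOf : ∀ {I} i j .(i≢j : i ≢ j) → c i j i≢j ∈ packingOf I
  leaf∈packingOf i j i≢j = ∈-++⁺ˡ (∈-leaves⁺ i j i≢j)

  packingOf-unique : ∀ {I} → Unique I → Unique (packingOf I)
  packingOf-unique u = Unique.++⁺ (leaves-unique n) (Unique.map⁺ (λ { refl → refl }) u) disjoint
    where
    disjoint : ∀ {x} → ¬ (x ∈ leaves n × x ∈ map (λ i → a i i) _)
    disjoint (x∈leaves , x∈diag) with ∈-leaves⁻ x∈leaves | ∈-map⁻ _ x∈diag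
    ... | leaf _ _ _ | _ , _ , ()

  packingOf-cong : ∀ {I I′} → SameSet (Adj G) I I′ → SameSet (StarAdj G) (packingOf I) (packingOf I′)
  packingOf-cong I≈I′ x = transport (λ i∈ → proj₁ (I≈I′ _) i∈) , transport (λ i∈ → proj₂ (I≈I′ _) i∈)
    where
    transport : ∀ {I J} → I ⊆ J → x ∈ packingOf I → x ∈ packingOf J
    transport I⊆J x∈ with ∈-packingOf⁻ x∈
    ... | inj₁ (leaf i j i≢j)     = leaf∈packingOf i j i≢j
    ... | inj₂ (_ , i∈I , refl) = diagonal∈packingOf (I⊆J i∈I)

  N-leaf : ∀ {i j w} .{i≢j} → N (c i j i≢j) w → (w ≡ c i j i≢j) ⊎ (w ≡ b i j i≢j)
  N-leaf (inj₁ refl)       = inj₁ refl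
  N-leaf (inj₂ (inj₁ ()))
  N-leaf (inj₂ (inj₂ bc))  = inj₂ refl

  data NearDiagonal (i : Fin n) : V → Set where
    same-row    : ∀ l → NearDiagonal i (a i l)
    same-column : ∀ {m} → Adj G i m → NearDiagonal i (a m i)

  N-diagonal : ∀ {i w} → N (a i i) w → NearDiagonal i w
  N-diagonal (inj₁ refl)               = same-row _
  N-diagonal (inj₂ (inj₁ (aa-G i~m)))  = same-column i~m
  N-diagonal (inj₂ (inj₁ (aa-K _)))    = same-row _
  N-diagonal (inj₂ (inj₂ (aa-G m~i)))  = same-column (sym G m~i)
  N-diagonal (inj₂ (inj₂ (aa-K _)))    = same-row _
  N-diagonal (inj₂ (inj₂ (ba {p = i≢i}))) = Irrelevant.⊥-elim (i≢i refl)

  packingOf-packing : ∀ {I} → Ind I → Packing (packingOf I)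
  packingOf-packing {I} ind x∈ y∈ x≢y w (nx , ny) = apart (∈-packingOf⁻ x∈) (∈-packingOf⁻ y∈) x≢y nx ny
    where
    leaf-diagonal : ∀ {x i} → Leaf x → N x w → N (a i i) w → ⊥
    leaf-diagonal (leaf _ _ _) nx ny with N-leaf nx | N-diagonal ny
    ... | inj₁ refl | ()
    ... | inj₂ refl | ()

    apart : ∀ {x y} → Leaf x ⊎ ∃ (λ i → i ∈ I × x ≡ a i i) → Leaf y ⊎ ∃ (λ i → i ∈ I × y ≡ a i i) →
            x ≢ y → N x w → N y w → ⊥
    apart (inj₁ (leaf _ _ _)) (inj₁ (leaf _ _ _)) x≢y nx ny with N-leaf nx | N-leaf ny
    ... | inj₁ refl | inj₁ refl = x≢y refl
    ... | inj₂ refl | inj₂ refl = x≢y refl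
    apart (inj₁ x-leaf) (inj₂ (_ , _ , refl)) _ nx ny = leaf-diagonal x-leaf nx ny
    apart (inj₂ (_ , _ , refl)) (inj₁ y-leaf) _ nx ny = leaf-diagonal y-leaf ny nx
    apart (inj₂ (i , i∈I , refl)) (inj₂ (j , j∈I , refl)) x≢y nx ny with N-diagonal nx | N-diagonal ny
    ... | same-row _      | same-row _      = x≢y refl
    ... | same-row _      | same-column j~i = ind j∈I i∈I j~i
    ... | same-column i~j | same-row _      = ind i∈I j∈I i~j
    ... | same-column _   | same-column _   = x≢y refl

  diagonal∈? : (T : List V) (i : Fin n) → Dec (a i i ∈ T)
  diagonal∈? T i = any? (a i i ≟V_) T

  diagonalOf : List V → List (Fin n)
  diagonalOf T = filter (diagonal∈? T) (allFin n)

  ∈-diagonalOf⁺ : ∀ {T i} → a i i ∈ T → i ∈ diagonalOf T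
  ∈-diagonalOf⁺ {T} {i} a∈T = ∈-filter⁺ (diagonal∈? T) (∈-allFin i) a∈T

  ∈-diagonalOf⁻ : ∀ {T i} → i ∈ diagonalOf T → a i i ∈ T
  ∈-diagonalOf⁻ {T} i∈ = proj₂ (∈-filter⁻ (diagonal∈? T) {xs = allFin n} i∈)

  diagonalOf-unique : ∀ {T} → Unique (diagonalOf T)
  diagonalOf-unique {T} = Unique.filter⁺ (diagonal∈? T) (Unique.allFin⁺ n)

  diagonalOf-cong : ∀ {T T′} → SameSet (StarAdj G) T T′ → SameSet (Adj G) (diagonalOf T) (diagonalOf T′)
  diagonalOf-cong T≈T′ i =
    (λ i∈ → ∈-diagonalOf⁺ (proj₁ (T≈T′ _) (∈-diagonalOf⁻ i∈))) ,
    (λ i∈ → ∈-diagonalOf⁺ (proj₂ (T≈T′ _) (∈-diagonalOf⁻ i∈)))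

  diagonalOf-packingOf : ∀ I → SameSet (Adj G) (diagonalOf (packingOf I)) I
  diagonalOf-packingOf I i =
    (λ i∈ → diagonal∈packingOf⁻ (∈-diagonalOf⁻ i∈)) , (λ i∈I → ∈-diagonalOf⁺ (diagonal∈packingOf i∈I))

  -- The diagonal of a 2-packing is independent: adjacent i, j would meet at (a_j,v_i).
  diagonalOf-independent : ∀ {T} → Packing T → Ind (diagonalOf T)
  diagonalOf-independent pk {i} {j} i∈ j∈ i~j =
    clash pk (∈-diagonalOf⁻ i∈) (∈-diagonalOf⁻ j∈) (λ { refl → irrefl G i~j })
      (inj₂ (inj₁ (aa-G i~j))) (N-row j j i)

  slots-covered : ∀ T → map slot T ⊆ map slot (packingOf (diagonalOf T))
  slots-covered T s∈ with ∈-map⁻ slot s∈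
  ... | x , x∈T , refl with slot x in eq
  ... | inj₁ i = subst (_∈ _) (slot-diagonal i)
                   (∈-map⁺ slot (diagonal∈packingOf (∈-diagonalOf⁺ (subst (_∈ T) (slot-inj₁ eq) x∈T))))
  ... | inj₂ (i , j) = ∈-map⁺ slot (leaf∈packingOf {diagonalOf T} i j (proj₁ (slot-inj₂ {x} eq)))

  packing-bound : ∀ {T} → Packing T → Unique T → length T ≤ length (packingOf (diagonalOf T))
  packing-bound {T} pk u = begin
    length T                                   ≡⟨ ≡.sym (length-map slot T) ⟩
    length (map slot T)                        ≤⟨ card-≤ (map-Unique slot (slot-injective pk) u) (slots-covered T) ⟩
    length (map slot (packingOf (diagonalOf T))) ≡⟨ length-map slot (packingOf (diagonalOf T)) ⟩
    length (packingOf (diagonalOf T))          ∎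
    where open ≤-Reasoning

  packingOf-maximum : ∀ {I} → IsMaximum (Adj G) Ind I → IsMaximum (StarAdj G) Packing (packingOf I)
  packingOf-maximum {I} (ind , u , largest) = packingOf-packing ind , packingOf-unique u , bound
    where
    open ≤-Reasoning
    bound : ∀ T → Packing T → Unique T → length T ≤ length (packingOf I)
    bound T pk uT = begin
      length T                              ≤⟨ packing-bound pk uT ⟩
      length (packingOf (diagonalOf T))     ≡⟨ length-packingOf _ ⟩
      n * (n ∸ 1) + length (diagonalOf T)   ≤⟨ +-monoʳ-≤ (n * (n ∸ 1))
                                                 (largest _ (diagonalOf-independent pk) diagonalOf-unique) ⟩
      n * (n ∸ 1) + length I                ≡⟨ ≡.sym (length-packingOf I) ⟩
      length (packingOf I)                  ∎

  diagonalOf-maximum : ∀ {T} → IsMaximum (StarAdj G) Packing T → IsMaximum (Adj G) Ind (diagonalOf T)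
  diagonalOf-maximum {T} (pk , u , largest) = diagonalOf-independent pk , diagonalOf-unique , bound
    where
    open ≤-Reasoning
    bound : ∀ L → Ind L → Unique L → length L ≤ length (diagonalOf T)
    bound L ind uL = +-cancelˡ-≤ (n * (n ∸ 1)) _ _ (begin
      n * (n ∸ 1) + length L                ≡⟨ ≡.sym (length-packingOf L) ⟩
      length (packingOf L)                  ≤⟨ largest _ (packingOf-packing ind) (packingOf-unique uL) ⟩
      length T                              ≤⟨ packing-bound pk u ⟩
      length (packingOf (diagonalOf T))     ≡⟨ length-packingOf _ ⟩
      n * (n ∸ 1) + length (diagonalOf T)   ∎)

  -- In a maximum 2-packing every gadget is occupied: otherwise the slot count
  -- would fall short of that of packingOf (diagonalOf T).
  gadget-occupied : ∀ {T} → IsMaximum (StarAdj G) Packing T →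
                    ∀ {i j} (i≢j : i ≢ j) → ∃ λ y → y ∈ T × Gadget i j i≢j y
  gadget-occupied {T} (pk , u , largest) {i} {j} i≢j
    with ∈-map⁻ slot (card-saturated _≟S_ slots-unique (slots-covered T) enough
                        (∈-map⁺ slot (leaf∈packingOf {diagonalOf T} i j i≢j)))
    where
    slots-unique : Unique (map slot T)
    slots-unique = map-Unique slot (slot-injective pk) u
    enough : length (map slot (packingOf (diagonalOf T))) ≤ length (map slot T)
    enough = subst₂ _≤_ (≡.sym (length-map slot (packingOf (diagonalOf T)))) (≡.sym (length-map slot T))
      (largest _ (packingOf-packing (diagonalOf-independent pk)) (packingOf-unique (diagonalOf-unique {T})))
  ... | y , y∈T , eq = y , y∈T , proj₂ (slot-inj₂ (≡.sym eq))

  module MaximumPacking {T : List V} (maxT : IsMaximum (StarAdj G) Packing T) where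

    packing : Packing T
    packing = proj₁ maxT

    neighbour-on-diagonal : ∀ {i} → i ∉ diagonalOf T → ∃ λ m → a m m ∈ T × Adj G i m
    neighbour-on-diagonal i∉ with maximum-dominates G (diagonalOf-maximum maxT) i∉
    ... | m , m∈ , i~m = m , ∈-diagonalOf⁻ m∈ , i~m

    -- (a_i,v_k) ∉ T for i ≢ k: it meets (a_i,v_i) at itself, so i is off the diagonal,
    -- and then it meets the diagonal neighbour (a_m,v_m) at (a_i,v_m).
    no-off-diagonal : ∀ {i k} → a i k ∈ T → i ≢ k → ⊥
    no-off-diagonal {i} {k} a∈T i≢k with neighbour-on-diagonal off
      where
      off : i ∉ diagonalOf T
      off i∈ = clash packing a∈T (∈-diagonalOf⁻ i∈) (λ { refl → i≢k refl }) (inj₁ refl) (N-row i i k)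
    ... | m , aₘ∈T , i~m = clash packing a∈T aₘ∈T (λ { refl → irrefl G i~m })
                             (N-row i k m) (inj₂ (inj₁ (aa-G (sym G i~m))))

    -- b_ij ∉ T: it meets (a_i,v_i) at (a_i,v_j), so i has a diagonal neighbour m.
    -- If m = j, b_ij meets (a_j,v_j) at (a_i,v_j); otherwise it meets the occupant
    -- of the gadget (i,m), which is b_im or c_im, at b_im.
    no-centre : ∀ {i j} .{i≢j} → b i j i≢j ∈ T → ⊥
    no-centre {i} {j} b∈T with neighbour-on-diagonal off
      where
      off : i ∉ diagonalOf T
      off i∈ = clash packing b∈T (∈-diagonalOf⁻ i∈) (λ ()) (inj₂ (inj₁ ba)) (N-row i i j)
    ... | m , aₘ∈T , i~m with j ≟F m
    ...   | yes refl = clash packing b∈T aₘ∈T (λ ()) (inj₂ (inj₁ ba)) (inj₂ (inj₁ (aa-G (sym G i~m))))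
    ...   | no  j≢m with gadget-occupied maxT (λ { refl → irrefl G i~m })
    ...     | y , y∈T , at-a = no-off-diagonal y∈T (λ { refl → irrefl G i~m })
    ...     | y , y∈T , at-b = clash packing b∈T y∈T (λ { refl → j≢m refl }) (inj₂ (inj₁ (bb j≢m))) (inj₁ refl)
    ...     | y , y∈T , at-c = clash packing b∈T y∈T (λ ()) (inj₂ (inj₁ (bb j≢m))) (inj₂ (inj₂ bc))

    structure : SameSet (StarAdj G) T (packingOf (diagonalOf T))
    structure x = to x , from
      where
      to : ∀ x → x ∈ T → x ∈ packingOf (diagonalOf T)
      to (a i k) a∈T with i ≟F k
      ... | yes refl = diagonal∈packingOf (∈-diagonalOf⁺ a∈T)
      ... | no  i≢k  = ⊥-elim (no-off-diagonal a∈T i≢k)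
      to (b i j _) b∈T = ⊥-elim (no-centre b∈T)
      to (c i j i≢j) _ = leaf∈packingOf i j i≢j

      from : x ∈ packingOf (diagonalOf T) → x ∈ T
      from x∈ with ∈-packingOf⁻ x∈
      ... | inj₂ (i , i∈ , refl) = ∈-diagonalOf⁻ i∈
      ... | inj₁ (leaf i j i≢j) with gadget-occupied maxT (recover i≢j)
      ...   | y , y∈T , at-a = ⊥-elim (no-off-diagonal y∈T (recover i≢j))
      ...   | y , y∈T , at-b = ⊥-elim (no-centre y∈T)
      ...   | y , y∈T , at-c = y∈T

mainTheorem8 : ∀ {n : ℕ} (G : SimpleGraph n) →
    (∀ k → IndependenceNumber (Adj G) k →
    PackingNumber (StarAdj G) (n * (n ∸ 1) + k))
    × (UniqueMaximum (Adj G) (Independent (Adj G))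
    ⇔ UniqueMaximum (StarAdj G) (TwoPacking (StarAdj G)))
mainTheorem8 {n} G = packingNumber , mk⇔ forward backward
  where
  open Star G

  packingNumber : ∀ k → IndependenceNumber (Adj G) k → PackingNumber (StarAdj G) (n * (n ∸ 1) + k)
  packingNumber k (I , maxI , |I|≡k) =
    packingOf I , packingOf-maximum maxI , ≡.trans (length-packingOf I) (cong (n * (n ∸ 1) +_) |I|≡k)

  -- Every maximum 2-packing T equals packingOf (diagonalOf T), and diagonalOf T = I.
  forward : UniqueMaximum (Adj G) Ind → UniqueMaximum (StarAdj G) Packing
  forward (I , maxI , unique) = packingOf I , packingOf-maximum maxI , λ T maxT →
    sameSet-trans {R = StarAdj G} (packingOf-cong (unique _ (diagonalOf-maximum maxT)))
                  (sameSet-sym {R = StarAdj G} (MaximumPacking.structure maxT))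

  -- For every maximum independent set I, packingOf I = S, so I = diagonalOf S.
  backward : UniqueMaximum (StarAdj G) Packing → UniqueMaximum (Adj G) Ind
  backward (S , maxS , unique) = diagonalOf S , diagonalOf-maximum maxS , λ I maxI →
    sameSet-trans {R = Adj G} (diagonalOf-cong (unique _ (packingOf-maximum maxI))) (diagonalOf-packingOf I)
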